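{- Let $q$ be a power of $2$ and $k=2q$. There exists a balanced pairwise independent subgroup of $\mathbb{F}_q^k$ such that every element of the subgroup has an even number of coordinates equal to $0$.
   Context: A subset $H\subseteq\mathbb{F}_q^k$ is balanced pairwise independent if, for $x$ uniform on $H$, $\Pr[x_i=g]=1/q$ for all $i$ and $g$, and $\Pr[x_i=g,x_j=g']=1/q^2$ for all $i\neq j$ and $g,g'\in\mathbb{F}_q$. -}

module Defs where

open import Data.Nat as ℕ using (ℕ)
open import Data.Nat.Divisibility using (_∣_)
open import Data.Fin using (Fin)
import Data.Fin.Properties as FinP
open import Data.Vec using (Vec; lookup; zipWith; map; replicate; count)
open import Data.List using (List; length; filter)
open import Data.List.Membership.Propositional using (_∈_)
open import Data.List.Relation.Unary.Unique.Propositional using (Unique)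
open import Data.Product using (∃; _×_)
open import Relation.Binary.PropositionalEquality using (_≡_; _≢_; cong; sym; trans)
open import Relation.Binary.Definitions using (DecidableEquality)
open import Relation.Nullary using (¬_; yes; no)
open import Relation.Nullary.Decidable using (map′; _×-dec_)
open import Function.Bundles using (_↔_; Inverse)
open import Algebra.Structures using (IsCommutativeRing)

record FiniteField (q : ℕ) : Set₁ where
  infixl 6 _+_
  infixl 7 _*_
  field
    Carrier : Set
    _+_ _*_ : Carrier → Carrier → Carrier
    -_      : Carrier → Carrier
    0# 1#   : Carrier
    isCommutativeRing : IsCommutativeRing _≡_ _+_ _*_ -_ 0# 1#
    0≢1     : 0# ≢ 1#
    inverse : ∀ x → x ≢ 0# → ∃ λ y → x * y ≡ 1#
    enum    : Fin q ↔ Carrier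

  _≟_ : DecidableEquality Carrier
  x ≟ y = map′ back (cong (Inverse.from enum)) (Inverse.from enum x FinP.≟ Inverse.from enum y)
    where
    back : Inverse.from enum x ≡ Inverse.from enum y → x ≡ y
    back e = trans (sym (Inverse.strictlyInverseˡ enum x))
               (trans (cong (Inverse.to enum) e) (Inverse.strictlyInverseˡ enum y))

module _ {q : ℕ} (F : FiniteField q) where
  open FiniteField F

  _⊕_ : ∀ {k} → Vec Carrier k → Vec Carrier k → Vec Carrier k
  _⊕_ = zipWith _+_

  ⊝_ : ∀ {k} → Vec Carrier k → Vec Carrier k
  ⊝_ = map -_

  𝟎 : ∀ {k} → Vec Carrier k
  𝟎 = replicate _ 0#

  -- A finite subset H of F_q^k, given as a duplicate-free list of its
  -- elements, is an (additive) subgroup.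
  IsSubgroup : ∀ {k} → List (Vec Carrier k) → Set
  IsSubgroup H = 𝟎 ∈ H
               × (∀ {x y} → x ∈ H → y ∈ H → (x ⊕ y) ∈ H)
               × (∀ {x} → x ∈ H → (⊝ x) ∈ H)

  -- Pr[x_i = g] = 1/q, i.e. q · #{x ∈ H | x_i = g} = |H|
  -- Pr[x_i = g, x_j = g'] = 1/q², i.e. q² · #{x ∈ H | x_i = g ∧ x_j = g'} = |H|
  IsBalancedPairwiseIndependent : ∀ {k} → List (Vec Carrier k) → Set
  IsBalancedPairwiseIndependent {k} H =
      (∀ (i : Fin k) (g : Carrier) →
         q ℕ.* length (filter (λ x → lookup x i ≟ g) H) ≡ length H)
    × (∀ (i j : Fin k) → i ≢ j → ∀ (g g′ : Carrier) →
         (q ℕ.* q) ℕ.* length (filter (λ x → (lookup x i ≟ g) ×-dec (lookup x j ≟ g′)) H)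
           ≡ length H)

  zeros : ∀ {k} → Vec Carrier k → ℕ
  zeros x = count (_≟ 0#) x

-- H is the image of the additive map φ : F³ → F^{2q},
--   φ (a , b , c) = ((a x + b) over x ∈ F , (a x + c) over x ∈ F),
-- which is injective, so H is a copy of F³. As (a , b , c) ranges over F³, a single coordinate
-- a x + b hits each value q² times (b is determined by a, c is free), and two distinct
-- coordinates hit each pair of values q times: within one block, a x + b = g and a x′ + b = g′
-- determine a and b; across the blocks, b and c are determined by a. If a ≠ 0 each block has
-- exactly one zero coordinate (x = − b / a); if a = 0 each block has 0 or q of them, and q is
-- even.

module Submission where

open import Defs
open import Data.Nat using (ℕ; _*_; _^_)
open import Data.Nat.Divisibility using (_∣_)
open import Data.Vec using (Vec)
open import Data.List using (List)
open import Data.List.Membership.Propositional using (_∈_)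
open import Data.List.Relation.Unary.Unique.Propositional using (Unique)
open import Data.Product using (Σ; _×_)

open import Algebra.Bundles using (CommutativeRing)
import Algebra.Properties.CommutativeSemigroup as CommutativeSemigroupProperties
import Algebra.Properties.Ring as RingProperties
open import Algebra.Structures using (IsCommutativeRing)
open import Data.Bool using (true; false; if_then_else_)
open import Data.Empty using (⊥-elim)
open import Data.Fin as Fin using (Fin; splitAt; _↑ˡ_; _↑ʳ_)
import Data.Fin.Properties as Finₚ
open import Data.List using ([]; _∷_; _++_; map; length; filter; tabulate; cartesianProduct)
import Data.List.Properties as Listₚ
open import Data.List.Membership.Propositional.Properties
  using (∈-map⁺; ∈-map⁻; ∈-tabulate⁺; ∈-cartesianProduct⁺)
open import Data.List.Relation.Unary.All as All using (All; []; _∷_)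
open import Data.List.Relation.Unary.AllPairs using (_∷_)
open import Data.List.Relation.Unary.Any using (here; there)
import Data.List.Relation.Unary.Unique.Propositional.Properties as Unique
open import Data.Nat using (zero; suc; _+_)
open import Data.Nat.Divisibility using (_∣0; ∣-refl; m∣m*n; ∣m⇒∣m*n; ∣m∣n⇒∣m+n)
open import Data.Nat.ListAction using (sum)
open import Data.Nat.ListAction.Properties using (sum-++)
import Data.Nat.Properties as ℕₚ
open import Data.Product using (_,_; proj₁; proj₂; ∃)
open import Data.Sum using (inj₁; inj₂)
import Data.Vec as Vec
import Data.Vec.Properties as Vecₚ
open import Function using (_∘_; _↔_; Inverse; Injection)
open import Function.Properties.Inverse using (Inverse⇒Injection)
open import Level using (0ℓ)
open import Relation.Binary.PropositionalEquality
open import Relation.Nullary using (Dec; yes; no; does; ¬_)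
open import Relation.Nullary.Decidable using (_×-dec_; dec-true; dec-false)
open import Relation.Unary using (Pred; Decidable)

open CommutativeSemigroupProperties ℕₚ.+-commutativeSemigroup using () renaming (interchange to +-interchange)

𝟙 : ∀ {p} {P : Set p} → Dec P → ℕ
𝟙 d = if does d then 1 else 0

𝟙-yes : ∀ {p} {P : Set p} (d : Dec P) → P → 𝟙 d ≡ 1
𝟙-yes d p = cong (λ b → if b then 1 else 0) (dec-true d p)

𝟙-no : ∀ {p} {P : Set p} (d : Dec P) → ¬ P → 𝟙 d ≡ 0
𝟙-no d ¬p = cong (λ b → if b then 1 else 0) (dec-false d ¬p)

∑ : ∀ {a} {A : Set a} → List A → (A → ℕ) → ℕ
∑ xs f = sum (map f xs)

infixr 5 ∑
syntax ∑ xs (λ x → e) = ∑[ x ∈ xs ] e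

module _ {a} {A : Set a} where

  ∑-cong : ∀ {f g : A → ℕ} → (∀ x → f x ≡ g x) → ∀ xs → ∑ xs f ≡ ∑ xs g
  ∑-cong f≗g xs = cong sum (Listₚ.map-cong f≗g xs)

  ∑-++ : ∀ (f : A → ℕ) xs ys → ∑ (xs ++ ys) f ≡ ∑ xs f + ∑ ys f
  ∑-++ f xs ys = trans (cong sum (Listₚ.map-++ f xs ys)) (sum-++ (map f xs) (map f ys))

  ∑-const : ∀ n (xs : List A) → ∑[ _ ∈ xs ] n ≡ length xs * n
  ∑-const n []       = refl
  ∑-const n (x ∷ xs) = cong (n +_) (∑-const n xs)

  ∑-*ˡ : ∀ n (f : A → ℕ) xs → ∑[ x ∈ xs ] n * f x ≡ n * ∑ xs f
  ∑-*ˡ n f []       = sym (ℕₚ.*-zeroʳ n)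
  ∑-*ˡ n f (x ∷ xs) = trans (cong (n * f x +_) (∑-*ˡ n f xs)) (sym (ℕₚ.*-distribˡ-+ n (f x) _))

  ∑-+ : ∀ (f g : A → ℕ) xs → ∑[ x ∈ xs ] (f x + g x) ≡ ∑ xs f + ∑ xs g
  ∑-+ f g []       = refl
  ∑-+ f g (x ∷ xs) = trans (cong (f x + g x +_) (∑-+ f g xs)) (+-interchange (f x) (g x) _ _)

  ∑-zero : ∀ {f : A → ℕ} {xs} → All (λ x → f x ≡ 0) xs → ∑ xs f ≡ 0
  ∑-zero []         = refl
  ∑-zero (fx≡0 ∷ p) = cong₂ _+_ fx≡0 (∑-zero p)

  ∑-unique : ∀ {f : A → ℕ} {x₀ xs} → Unique xs → x₀ ∈ xs →
             (∀ x → x ≢ x₀ → f x ≡ 0) → ∑ xs f ≡ f x₀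
  ∑-unique {f} {x₀} (x₀∉xs ∷ _) (here refl) vanish =
    trans (cong (f x₀ +_) (∑-zero (All.map (λ x₀≢x → vanish _ (x₀≢x ∘ sym)) x₀∉xs))) (ℕₚ.+-identityʳ _)
  ∑-unique (x∉xs ∷ xs-unique) (there x₀∈xs) vanish =
    cong₂ _+_ (vanish _ (All.lookup x∉xs x₀∈xs)) (∑-unique xs-unique x₀∈xs vanish)

  length-filter : ∀ {p} {P : Pred A p} (P? : Decidable P) xs →
                  length (filter P? xs) ≡ ∑[ x ∈ xs ] 𝟙 (P? x)
  length-filter P? []       = refl
  length-filter P? (x ∷ xs) with does (P? x)
  ... | true  = cong suc (length-filter P? xs)
  ... | false = length-filter P? xs

∑-map : ∀ {a b} {A : Set a} {B : Set b} (f : B → ℕ) (g : A → B) xs →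
        ∑ (map g xs) f ≡ ∑[ x ∈ xs ] f (g x)
∑-map f g xs = cong sum (sym (Listₚ.map-∘ xs))

module _ {a b} {A : Set a} {B : Set b} where

  ∑-comm : ∀ (f : A → B → ℕ) xs ys → ∑[ x ∈ xs ] ∑[ y ∈ ys ] f x y ≡ ∑[ y ∈ ys ] ∑[ x ∈ xs ] f x y
  ∑-comm f []       ys = sym (∑-zero (All.universal (λ _ → refl) ys))
  ∑-comm f (x ∷ xs) ys = trans (cong (∑ ys (f x) +_) (∑-comm f xs ys))
                               (sym (∑-+ (f x) (λ y → ∑[ x ∈ xs ] f x y) ys))

  ∑-cartesianProduct : ∀ (f : A × B → ℕ) xs ys →
                       ∑ (cartesianProduct xs ys) f ≡ ∑[ x ∈ xs ] ∑[ y ∈ ys ] f (x , y)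
  ∑-cartesianProduct f []       ys = refl
  ∑-cartesianProduct f (x ∷ xs) ys = trans (∑-++ f (map (x ,_) ys) _)
    (cong₂ _+_ (∑-map f (x ,_) ys) (∑-cartesianProduct f xs ys))

module _ {b p} {B : Set b} {P : Pred B p} (P? : Decidable P) where

  count-++ : ∀ {m n} (xs : Vec B m) (ys : Vec B n) →
             Vec.count P? (xs Vec.++ ys) ≡ Vec.count P? xs + Vec.count P? ys
  count-++ Vec.[]       ys = refl
  count-++ (x Vec.∷ xs) ys with does (P? x)
  ... | true  = cong suc (count-++ xs ys)
  ... | false = count-++ xs ys

  count-tabulate : ∀ {a n} {A : Set a} (f : A → B) (g : Fin n → A) →
                   Vec.count P? (Vec.tabulate (f ∘ g)) ≡ ∑[ x ∈ tabulate g ] 𝟙 (P? (f x))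
  count-tabulate {n = zero}  f g = refl
  count-tabulate {n = suc n} f g with does (P? (f (g Fin.zero)))
  ... | true  = cong suc (count-tabulate f (g ∘ Fin.suc))
  ... | false = count-tabulate f (g ∘ Fin.suc)

length-cartesianProduct : ∀ {a b} {A : Set a} {B : Set b} (xs : List A) (ys : List B) →
                          length (cartesianProduct xs ys) ≡ length xs * length ys
length-cartesianProduct []       ys = refl
length-cartesianProduct (x ∷ xs) ys = begin
  length (map (x ,_) ys ++ cartesianProduct xs ys)    ≡⟨ Listₚ.length-++ (map (x ,_) ys) ⟩
  length (map (x ,_) ys) + length (cartesianProduct xs ys)
    ≡⟨ cong₂ _+_ (Listₚ.length-map (x ,_) ys) (length-cartesianProduct xs ys) ⟩
  length ys + length xs * length ys                  ∎
  where open ≡-Reasoning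

module Enumeration {a n} {A : Set a} (enum : Fin n ↔ A) where
  open Inverse enum

  elements : List A
  elements = tabulate to

  elements-unique : Unique elements
  elements-unique = Unique.tabulate⁺ (Injection.injective (Inverse⇒Injection enum))

  ∈-elements : ∀ x → x ∈ elements
  ∈-elements x = subst (_∈ elements) (strictlyInverseˡ x) (∈-tabulate⁺ (from x))

  from-injective : ∀ {x y} → from x ≡ from y → x ≡ y
  from-injective {x} {y} e = trans (sym (strictlyInverseˡ x)) (trans (cong to e) (strictlyInverseˡ y))

  length-elements : length elements ≡ n
  length-elements = Listₚ.length-tabulate to

  ∑-elements-const : ∀ {f : A → ℕ} {k} → (∀ x → f x ≡ k) → ∑ elements f ≡ n * k
  ∑-elements-const {k = k} f≡k =
    trans (∑-cong f≡k elements) (trans (∑-const k elements) (cong (_* k) length-elements))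

  ∑-elements-𝟙 : ∀ {p} {P : Pred A p} (P? : Decidable P) {x₀} →
                 (∀ x → P x → x ≡ x₀) → ∑[ x ∈ elements ] 𝟙 (P? x) ≡ 𝟙 (P? x₀)
  ∑-elements-𝟙 P? unique =
    ∑-unique elements-unique (∈-elements _) (λ x x≢x₀ → 𝟙-no (P? x) (x≢x₀ ∘ unique x))

  elements³ : List (A × A × A)
  elements³ = cartesianProduct elements (cartesianProduct elements elements)

  elements³-unique : Unique elements³
  elements³-unique = Unique.cartesianProduct⁺ elements-unique
                       (Unique.cartesianProduct⁺ elements-unique elements-unique)

  ∈-elements³ : ∀ t → t ∈ elements³
  ∈-elements³ (a , b , c) =
    ∈-cartesianProduct⁺ (∈-elements a) (∈-cartesianProduct⁺ (∈-elements b) (∈-elements c))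

  length-elements³ : length elements³ ≡ n * (n * n)
  length-elements³ = begin
    length elements³
      ≡⟨ length-cartesianProduct elements _ ⟩
    length elements * length (cartesianProduct elements elements)
      ≡⟨ cong₂ _*_ length-elements (trans (length-cartesianProduct elements elements)
                                         (cong₂ _*_ length-elements length-elements)) ⟩
    n * (n * n) ∎
    where open ≡-Reasoning

  ∑-elements³ : ∀ (f : A × A × A → ℕ) →
                ∑ elements³ f ≡ ∑[ a ∈ elements ] ∑[ b ∈ elements ] ∑[ c ∈ elements ] f (a , b , c)
  ∑-elements³ f = trans (∑-cartesianProduct f elements _)
    (∑-cong (λ a → ∑-cartesianProduct (λ bc → f (a , bc)) elements elements) elements)

  ∑-elements³-swap : ∀ (f : A × A × A → ℕ) →
                     ∑ elements³ f ≡ ∑[ t ∈ elements³ ] f (proj₁ t , proj₂ (proj₂ t) , proj₁ (proj₂ t))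
  ∑-elements³-swap f = begin
    ∑ elements³ f
      ≡⟨ ∑-elements³ f ⟩
    ∑[ a ∈ elements ] ∑[ b ∈ elements ] ∑[ c ∈ elements ] f (a , b , c)
      ≡⟨ ∑-cong (λ a → ∑-comm (λ b c → f (a , b , c)) elements elements) elements ⟩
    ∑[ a ∈ elements ] ∑[ c ∈ elements ] ∑[ b ∈ elements ] f (a , b , c)
      ≡⟨ ∑-elements³ _ ⟨
    ∑[ t ∈ elements³ ] f (proj₁ t , proj₂ (proj₂ t) , proj₁ (proj₂ t)) ∎
    where open ≡-Reasoning

  ∑-elements³-ignoring-third : ∀ (f : A → A → ℕ) →
    ∑[ t ∈ elements³ ] f (proj₁ t) (proj₁ (proj₂ t)) ≡ n * (∑[ a ∈ elements ] ∑[ b ∈ elements ] f a b)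
  ∑-elements³-ignoring-third f = begin
    ∑[ t ∈ elements³ ] f (proj₁ t) (proj₁ (proj₂ t))
      ≡⟨ ∑-elements³ _ ⟩
    ∑[ a ∈ elements ] ∑[ b ∈ elements ] ∑[ c ∈ elements ] f a b
      ≡⟨ ∑-cong (λ a → ∑-cong (λ b → ∑-elements-const (λ _ → refl)) elements) elements ⟩
    ∑[ a ∈ elements ] ∑[ b ∈ elements ] n * f a b
      ≡⟨ ∑-cong (λ a → ∑-*ˡ n (f a) elements) elements ⟩
    ∑[ a ∈ elements ] n * (∑[ b ∈ elements ] f a b)
      ≡⟨ ∑-*ˡ n _ elements ⟩
    n * (∑[ a ∈ elements ] ∑[ b ∈ elements ] f a b) ∎
    where open ≡-Reasoning

commutativeRing : ∀ {q} → FiniteField q → CommutativeRing 0ℓ 0ℓ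
commutativeRing F = record { isCommutativeRing = FiniteField.isCommutativeRing F }

module LinearEquations {q} (F : FiniteField q) where
  open FiniteField F public
    renaming (_+_ to _+ᶠ_; _*_ to _*ᶠ_; -_ to -ᶠ_; _≟_ to infix 4 _≟_)
  open IsCommutativeRing isCommutativeRing public using () renaming (_-_ to _-ᶠ_)
  open IsCommutativeRing isCommutativeRing using (+-comm; *-comm; *-assoc; *-identityʳ)
  open RingProperties (CommutativeRing.ring (commutativeRing F))
    using (//-rightDividesˡ; //-rightDividesʳ; x∙y⁻¹≈ε⇒x≈y)

  _/⟨_⟩ : ∀ {u} → Carrier → u ≢ 0# → Carrier
  v /⟨ u≢0 ⟩ = v *ᶠ proj₁ (inverse _ u≢0)

  /-solves : ∀ {u} (u≢0 : u ≢ 0#) v → (v /⟨ u≢0 ⟩) *ᶠ u ≡ v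
  /-solves {u} u≢0 v = begin
    (v *ᶠ u⁻¹) *ᶠ u  ≡⟨ *-assoc v u⁻¹ u ⟩
    v *ᶠ (u⁻¹ *ᶠ u)  ≡⟨ cong (v *ᶠ_) (*-comm u⁻¹ u) ⟩
    v *ᶠ (u *ᶠ u⁻¹)  ≡⟨ cong (v *ᶠ_) (proj₂ (inverse u u≢0)) ⟩
    v *ᶠ 1#          ≡⟨ *-identityʳ v ⟩
    v                ∎
    where
    open ≡-Reasoning
    u⁻¹ : Carrier
    u⁻¹ = proj₁ (inverse u u≢0)

  /-unique : ∀ {u} (u≢0 : u ≢ 0#) {x v} → x *ᶠ u ≡ v → x ≡ v /⟨ u≢0 ⟩
  /-unique {u} u≢0 {x} {v} xu≡v = begin
    x                ≡⟨ *-identityʳ x ⟨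
    x *ᶠ 1#          ≡⟨ cong (x *ᶠ_) (proj₂ (inverse u u≢0)) ⟨
    x *ᶠ (u *ᶠ u⁻¹)  ≡⟨ *-assoc x u u⁻¹ ⟨
    (x *ᶠ u) *ᶠ u⁻¹  ≡⟨ cong (_*ᶠ u⁻¹) xu≡v ⟩
    v *ᶠ u⁻¹         ∎
    where
    open ≡-Reasoning
    u⁻¹ : Carrier
    u⁻¹ = proj₁ (inverse u u≢0)

  difference-solves : ∀ p g → p +ᶠ (g -ᶠ p) ≡ g
  difference-solves p g = trans (+-comm p (g -ᶠ p)) (//-rightDividesˡ p g)

  difference-unique : ∀ {p b g} → p +ᶠ b ≡ g → b ≡ g -ᶠ p
  difference-unique {p} {b} p+b≡g =
    trans (sym (//-rightDividesʳ p b)) (cong (_-ᶠ p) (trans (+-comm b p) p+b≡g))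

  difference-nonzero : ∀ {x x′} → x ≢ x′ → x′ -ᶠ x ≢ 0#
  difference-nonzero x≢x′ x′-x≡0 = x≢x′ (sym (x∙y⁻¹≈ε⇒x≈y _ _ x′-x≡0))

module Construction {q} (F : FiniteField q) where
  open LinearEquations F
  open IsCommutativeRing isCommutativeRing
    using (*-comm; zeroˡ; zeroʳ; +-identityˡ; +-identityʳ; *-identityʳ; distribʳ; -‿inverseˡ)
  open RingProperties (CommutativeRing.ring (commutativeRing F))
    using (+-cancelʳ; +-inverseˡ-unique; -‿distribˡ-*; -‿+-comm; x[y-z]≈xy-xz)
  open CommutativeSemigroupProperties (CommutativeRing.+-commutativeSemigroup (commutativeRing F))
    using (interchange; x∙yz≈y∙xz)
  open Inverse enum using (to; from; strictlyInverseˡ; strictlyInverseʳ)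
  open Enumeration enum

  data Block : Set where
    left right : Block

  Coordinate : Set
  Coordinate = Block × Carrier

  Triple : Set
  Triple = Carrier × Carrier × Carrier

  eval : Coordinate → Triple → Carrier
  eval (left  , x) (a , b , c) = a *ᶠ x +ᶠ b
  eval (right , x) (a , b , c) = a *ᶠ x +ᶠ c

  line : Carrier → Carrier → Vec Carrier q
  line a b = Vec.tabulate (λ k → a *ᶠ to k +ᶠ b)

  -- 2 * q reduces to q + (q + 0), hence the trailing [] here and the ↑ˡ 0 in index.
  φ : Triple → Vec Carrier (2 * q)
  φ (a , b , c) = line a b Vec.++ (line a c Vec.++ Vec.[])

  H : List (Vec Carrier (2 * q))
  H = map φ elements³

  index : Coordinate → Fin (2 * q)
  index (left  , x) = from x ↑ˡ (q + 0)
  index (right , x) = q ↑ʳ (from x ↑ˡ 0)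

  index-surjective : ∀ i → ∃ λ d → index d ≡ i
  index-surjective i with splitAt q i in split-i
  ... | inj₁ k = (left , to k) , trans (cong (_↑ˡ _) (strictlyInverseʳ k)) (Finₚ.splitAt⁻¹-↑ˡ split-i)
  ... | inj₂ j with splitAt q j in split-j
  ...   | inj₁ k = (right , to k) , (begin
    q ↑ʳ (from (to k) ↑ˡ 0) ≡⟨ cong (λ k → q ↑ʳ (k ↑ˡ 0)) (strictlyInverseʳ k) ⟩
    q ↑ʳ (k ↑ˡ 0)           ≡⟨ cong (q ↑ʳ_) (Finₚ.splitAt⁻¹-↑ˡ split-j) ⟩
    q ↑ʳ j                  ≡⟨ Finₚ.splitAt⁻¹-↑ʳ split-i ⟩
    i                       ∎)
    where open ≡-Reasoning

  lookup-line : ∀ a b x → Vec.lookup (line a b) (from x) ≡ a *ᶠ x +ᶠ b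
  lookup-line a b x =
    trans (Vecₚ.lookup∘tabulate _ (from x)) (cong (λ y → a *ᶠ y +ᶠ b) (strictlyInverseˡ x))

  lookup-φ : ∀ t d → Vec.lookup (φ t) (index d) ≡ eval d t
  lookup-φ (a , b , c) (left  , x) = trans (Vecₚ.lookup-++ˡ (line a b) _ (from x)) (lookup-line a b x)
  lookup-φ (a , b , c) (right , x) = begin
    Vec.lookup (line a b Vec.++ (line a c Vec.++ Vec.[])) (q ↑ʳ (from x ↑ˡ 0))
      ≡⟨ Vecₚ.lookup-++ʳ (line a b) _ (from x ↑ˡ 0) ⟩
    Vec.lookup (line a c Vec.++ Vec.[]) (from x ↑ˡ 0)
      ≡⟨ Vecₚ.lookup-++ˡ (line a c) Vec.[] (from x) ⟩
    Vec.lookup (line a c) (from x)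
      ≡⟨ lookup-line a c x ⟩
    a *ᶠ x +ᶠ c ∎
    where open ≡-Reasoning

  ≡-by-coordinates : ∀ {u v : Vec Carrier (2 * q)} →
                     (∀ d → Vec.lookup u (index d) ≡ Vec.lookup v (index d)) → u ≡ v
  ≡-by-coordinates {u} {v} u≐v = begin
    u                           ≡⟨ Vecₚ.tabulate∘lookup u ⟨
    Vec.tabulate (Vec.lookup u) ≡⟨ Vecₚ.tabulate-cong pointwise ⟩
    Vec.tabulate (Vec.lookup v) ≡⟨ Vecₚ.tabulate∘lookup v ⟩
    v                           ∎
    where
    open ≡-Reasoning
    pointwise : ∀ i → Vec.lookup u i ≡ Vec.lookup v i
    pointwise i with index-surjective i
    ... | d , refl = u≐v d

  eval-injective : ∀ {t t′} → (∀ d → eval d t ≡ eval d t′) → t ≡ t′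
  eval-injective {a , b , c} {a′ , b′ , c′} agree = cong₂ _,_ a≡a′ (cong₂ _,_ b≡b′ c≡c′)
    where
    at-0 : ∀ a b → a *ᶠ 0# +ᶠ b ≡ b
    at-0 a b = trans (cong (_+ᶠ b) (zeroʳ a)) (+-identityˡ b)
    b≡b′ : b ≡ b′
    b≡b′ = trans (sym (at-0 a b)) (trans (agree (left , 0#)) (at-0 a′ b′))
    c≡c′ : c ≡ c′
    c≡c′ = trans (sym (at-0 a c)) (trans (agree (right , 0#)) (at-0 a′ c′))
    a≡a′ : a ≡ a′
    a≡a′ = trans (sym (*-identityʳ a)) (trans
             (+-cancelʳ b _ _ (trans (agree (left , 1#)) (cong (a′ *ᶠ 1# +ᶠ_) (sym b≡b′))))
             (*-identityʳ a′))

  φ-injective : ∀ {t t′} → φ t ≡ φ t′ → t ≡ t′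
  φ-injective {t} {t′} e = eval-injective λ d →
    trans (sym (lookup-φ t d)) (trans (cong (λ v → Vec.lookup v (index d)) e) (lookup-φ t′ d))

  _+³_ : Triple → Triple → Triple
  (a , b , c) +³ (a′ , b′ , c′) = a +ᶠ a′ , b +ᶠ b′ , c +ᶠ c′

  -³_ : Triple → Triple
  -³ (a , b , c) = -ᶠ a , -ᶠ b , -ᶠ c

  affine-+ : ∀ a a′ x b b′ → (a +ᶠ a′) *ᶠ x +ᶠ (b +ᶠ b′) ≡ (a *ᶠ x +ᶠ b) +ᶠ (a′ *ᶠ x +ᶠ b′)
  affine-+ a a′ x b b′ = trans (cong (_+ᶠ (b +ᶠ b′)) (distribʳ x a a′)) (interchange _ _ _ _)

  affine-- : ∀ a x b → (-ᶠ a) *ᶠ x +ᶠ -ᶠ b ≡ -ᶠ (a *ᶠ x +ᶠ b)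
  affine-- a x b = trans (cong (_+ᶠ -ᶠ b) (sym (-‿distribˡ-* a x))) (-‿+-comm (a *ᶠ x) b)

  eval-+ : ∀ d t t′ → eval d (t +³ t′) ≡ eval d t +ᶠ eval d t′
  eval-+ (left  , x) _ _ = affine-+ _ _ x _ _
  eval-+ (right , x) _ _ = affine-+ _ _ x _ _

  eval-- : ∀ d t → eval d (-³ t) ≡ -ᶠ eval d t
  eval-- (left  , x) _ = affine-- _ x _
  eval-- (right , x) _ = affine-- _ x _

  eval-0 : ∀ d → eval d (0# , 0# , 0#) ≡ 0#
  eval-0 (left  , x) = trans (cong (_+ᶠ 0#) (zeroˡ x)) (+-identityʳ 0#)
  eval-0 (right , x) = trans (cong (_+ᶠ 0#) (zeroˡ x)) (+-identityʳ 0#)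

  φ-+ : ∀ t t′ → φ (t +³ t′) ≡ _⊕_ F (φ t) (φ t′)
  φ-+ t t′ = ≡-by-coordinates λ d → begin
    Vec.lookup (φ (t +³ t′)) (index d)
      ≡⟨ lookup-φ (t +³ t′) d ⟩
    eval d (t +³ t′)
      ≡⟨ eval-+ d t t′ ⟩
    eval d t +ᶠ eval d t′
      ≡⟨ cong₂ _+ᶠ_ (lookup-φ t d) (lookup-φ t′ d) ⟨
    Vec.lookup (φ t) (index d) +ᶠ Vec.lookup (φ t′) (index d)
      ≡⟨ Vecₚ.lookup-zipWith _+ᶠ_ (index d) (φ t) (φ t′) ⟨
    Vec.lookup (_⊕_ F (φ t) (φ t′)) (index d) ∎
    where open ≡-Reasoning

  φ-- : ∀ t → φ (-³ t) ≡ ⊝_ F (φ t)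
  φ-- t = ≡-by-coordinates λ d → begin
    Vec.lookup (φ (-³ t)) (index d)   ≡⟨ lookup-φ (-³ t) d ⟩
    eval d (-³ t)                     ≡⟨ eval-- d t ⟩
    -ᶠ eval d t                       ≡⟨ cong -ᶠ_ (lookup-φ t d) ⟨
    -ᶠ Vec.lookup (φ t) (index d)     ≡⟨ Vecₚ.lookup-map (index d) -ᶠ_ (φ t) ⟨
    Vec.lookup (⊝_ F (φ t)) (index d) ∎
    where open ≡-Reasoning

  φ-0 : φ (0# , 0# , 0#) ≡ 𝟎 F
  φ-0 = ≡-by-coordinates λ d →
    trans (lookup-φ _ d) (trans (eval-0 d) (sym (Vecₚ.lookup-replicate (index d) 0#)))

  H-unique : Unique H
  H-unique = Unique.map⁺ φ-injective elements³-unique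

  H-subgroup : IsSubgroup F H
  H-subgroup = subst (_∈ H) φ-0 (∈-H _) , closed-+ , closed--
    where
    ∈-H : ∀ t → φ t ∈ H
    ∈-H t = ∈-map⁺ φ (∈-elements³ t)
    closed-+ : ∀ {u v} → u ∈ H → v ∈ H → _⊕_ F u v ∈ H
    closed-+ u∈H v∈H with ∈-map⁻ φ u∈H | ∈-map⁻ φ v∈H
    ... | t , _ , refl | t′ , _ , refl = subst (_∈ H) (φ-+ t t′) (∈-H (t +³ t′))
    closed-- : ∀ {u} → u ∈ H → ⊝_ F u ∈ H
    closed-- u∈H with ∈-map⁻ φ u∈H
    ... | t , _ , refl = subst (_∈ H) (φ-- t) (∈-H (-³ t))

  fibre-left : ∀ x g → ∑[ t ∈ elements³ ] 𝟙 (eval (left , x) t ≟ g) ≡ q * q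
  fibre-left x g = begin
    ∑[ t ∈ elements³ ] 𝟙 (eval (left , x) t ≟ g)
      ≡⟨ ∑-elements³-ignoring-third (λ a b → 𝟙 (a *ᶠ x +ᶠ b ≟ g)) ⟩
    q * (∑[ a ∈ elements ] ∑[ b ∈ elements ] 𝟙 (a *ᶠ x +ᶠ b ≟ g))
      ≡⟨ cong (q *_) (∑-elements-const one-intercept) ⟩
    q * (q * 1)
      ≡⟨ cong (q *_) (ℕₚ.*-identityʳ q) ⟩
    q * q ∎
    where
    open ≡-Reasoning
    one-intercept : ∀ a → ∑[ b ∈ elements ] 𝟙 (a *ᶠ x +ᶠ b ≟ g) ≡ 1
    one-intercept a = trans (∑-elements-𝟙 (λ b → a *ᶠ x +ᶠ b ≟ g) (λ _ → difference-unique))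
                            (𝟙-yes (_ ≟ g) (difference-solves (a *ᶠ x) g))

  -- eval (right , x) (a , b , c) is definitionally eval (left , x) (a , c , b).
  fibre : ∀ d g → ∑[ t ∈ elements³ ] 𝟙 (eval d t ≟ g) ≡ q * q
  fibre (left  , x) g = fibre-left x g
  fibre (right , x) g = trans (∑-elements³-swap _) (fibre-left x g)

  pair-fibre-same-block : ∀ {x x′} → x ≢ x′ → ∀ g g′ →
    ∑[ t ∈ elements³ ] 𝟙 ((eval (left , x) t ≟ g) ×-dec (eval (left , x′) t ≟ g′)) ≡ q
  pair-fibre-same-block {x} {x′} x≢x′ g g′ = begin
    ∑[ t ∈ elements³ ] 𝟙 ((eval (left , x) t ≟ g) ×-dec (eval (left , x′) t ≟ g′))
      ≡⟨ ∑-elements³-ignoring-third (λ a b → 𝟙 (through a b)) ⟩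
    q * (∑[ a ∈ elements ] ∑[ b ∈ elements ] 𝟙 (through a b))
      ≡⟨ cong (q *_) (∑-cong (λ a → ∑-elements-𝟙 (through a) (λ _ → difference-unique ∘ proj₁))
                             elements) ⟩
    q * (∑[ a ∈ elements ] 𝟙 (through a (g -ᶠ a *ᶠ x)))
      ≡⟨ cong (q *_) (∑-elements-𝟙 (λ a → through a (g -ᶠ a *ᶠ x)) (λ _ → slope-unique ∘ proj₂)) ⟩
    q * 𝟙 (through a₀ (g -ᶠ a₀ *ᶠ x))
      ≡⟨ cong (q *_) (𝟙-yes (through a₀ _) (difference-solves (a₀ *ᶠ x) g , slope-solves)) ⟩
    q * 1
      ≡⟨ ℕₚ.*-identityʳ q ⟩
    q ∎
    where
    open ≡-Reasoning
    through : ∀ a b → Dec ((a *ᶠ x +ᶠ b ≡ g) × (a *ᶠ x′ +ᶠ b ≡ g′))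
    through a b = (a *ᶠ x +ᶠ b ≟ g) ×-dec (a *ᶠ x′ +ᶠ b ≟ g′)
    x′-x≢0 : x′ -ᶠ x ≢ 0#
    x′-x≢0 = difference-nonzero x≢x′
    a₀ : Carrier
    a₀ = (g′ -ᶠ g) /⟨ x′-x≢0 ⟩
    shift : ∀ a → a *ᶠ x′ +ᶠ (g -ᶠ a *ᶠ x) ≡ g +ᶠ a *ᶠ (x′ -ᶠ x)
    shift a = trans (x∙yz≈y∙xz (a *ᶠ x′) g _) (cong (g +ᶠ_) (sym (x[y-z]≈xy-xz a x′ x)))
    slope-unique : ∀ {a} → a *ᶠ x′ +ᶠ (g -ᶠ a *ᶠ x) ≡ g′ → a ≡ a₀
    slope-unique {a} e = /-unique x′-x≢0 (difference-unique (trans (sym (shift a)) e))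
    slope-solves : a₀ *ᶠ x′ +ᶠ (g -ᶠ a₀ *ᶠ x) ≡ g′
    slope-solves = trans (shift a₀)
      (trans (cong (g +ᶠ_) (/-solves x′-x≢0 (g′ -ᶠ g))) (difference-solves g g′))

  pair-fibre-across-blocks : ∀ x x′ g g′ →
    ∑[ t ∈ elements³ ] 𝟙 ((eval (left , x) t ≟ g) ×-dec (eval (right , x′) t ≟ g′)) ≡ q
  pair-fibre-across-blocks x x′ g g′ = begin
    ∑[ t ∈ elements³ ] 𝟙 ((eval (left , x) t ≟ g) ×-dec (eval (right , x′) t ≟ g′))
      ≡⟨ ∑-elements³ _ ⟩
    ∑[ a ∈ elements ] ∑[ b ∈ elements ] ∑[ c ∈ elements ] 𝟙 (through a b c)
      ≡⟨ ∑-cong (λ a → ∑-cong (λ b → ∑-elements-𝟙 (through a b) (λ _ → difference-unique ∘ proj₂))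
                               elements) elements ⟩
    ∑[ a ∈ elements ] ∑[ b ∈ elements ] 𝟙 (through a b (g′ -ᶠ a *ᶠ x′))
      ≡⟨ ∑-cong (λ a → ∑-elements-𝟙 (λ b → through a b _) (λ _ → difference-unique ∘ proj₁)) elements ⟩
    ∑[ a ∈ elements ] 𝟙 (through a (g -ᶠ a *ᶠ x) (g′ -ᶠ a *ᶠ x′))
      ≡⟨ ∑-elements-const (λ a → 𝟙-yes (through a _ _)
                                   (difference-solves (a *ᶠ x) g , difference-solves (a *ᶠ x′) g′)) ⟩
    q * 1
      ≡⟨ ℕₚ.*-identityʳ q ⟩
    q ∎
    where
    open ≡-Reasoning
    through : ∀ a b c → Dec ((a *ᶠ x +ᶠ b ≡ g) × (a *ᶠ x′ +ᶠ c ≡ g′))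
    through a b c = (a *ᶠ x +ᶠ b ≟ g) ×-dec (a *ᶠ x′ +ᶠ c ≟ g′)

  pair-fibre : ∀ {d d′} → d ≢ d′ → ∀ g g′ →
    ∑[ t ∈ elements³ ] 𝟙 ((eval d t ≟ g) ×-dec (eval d′ t ≟ g′)) ≡ q
  pair-fibre {left  , x} {left  , x′} d≢d′ = pair-fibre-same-block (d≢d′ ∘ cong (left ,_))
  pair-fibre {left  , x} {right , x′} _    = pair-fibre-across-blocks x x′
  pair-fibre {right , x} {left  , x′} _ g g′ =
    trans (∑-elements³-swap _) (pair-fibre-across-blocks x x′ g g′)
  pair-fibre {right , x} {right , x′} d≢d′ g g′ =
    trans (∑-elements³-swap _) (pair-fibre-same-block (d≢d′ ∘ cong (right ,_)) g g′)

  length-H : length H ≡ q * (q * q)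
  length-H = trans (Listₚ.length-map φ elements³) length-elements³

  length-filter-H : ∀ {p} {P : Pred (Vec Carrier (2 * q)) p} (P? : Decidable P) →
                    length (filter P? H) ≡ ∑[ t ∈ elements³ ] 𝟙 (P? (φ t))
  length-filter-H P? = trans (length-filter P? H) (∑-map _ φ elements³)

  H-fibre : ∀ d g → length (filter (λ v → Vec.lookup v (index d) ≟ g) H) ≡ q * q
  H-fibre d g = begin
    length (filter (λ v → Vec.lookup v (index d) ≟ g) H)
      ≡⟨ length-filter-H _ ⟩
    ∑[ t ∈ elements³ ] 𝟙 (Vec.lookup (φ t) (index d) ≟ g)
      ≡⟨ ∑-cong (λ t → cong (λ y → 𝟙 (y ≟ g)) (lookup-φ t d)) elements³ ⟩
    ∑[ t ∈ elements³ ] 𝟙 (eval d t ≟ g)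
      ≡⟨ fibre d g ⟩
    q * q ∎
    where open ≡-Reasoning

  H-pair-fibre : ∀ {d d′} → d ≢ d′ → ∀ g g′ →
    length (filter (λ v → (Vec.lookup v (index d) ≟ g) ×-dec (Vec.lookup v (index d′) ≟ g′)) H) ≡ q
  H-pair-fibre {d} {d′} d≢d′ g g′ = begin
    length (filter (λ v → (Vec.lookup v (index d) ≟ g) ×-dec (Vec.lookup v (index d′) ≟ g′)) H)
      ≡⟨ length-filter-H _ ⟩
    ∑[ t ∈ elements³ ] 𝟙 ((Vec.lookup (φ t) (index d) ≟ g) ×-dec (Vec.lookup (φ t) (index d′) ≟ g′))
      ≡⟨ ∑-cong (λ t → cong₂ (λ y y′ → 𝟙 ((y ≟ g) ×-dec (y′ ≟ g′))) (lookup-φ t d) (lookup-φ t d′))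
                elements³ ⟩
    ∑[ t ∈ elements³ ] 𝟙 ((eval d t ≟ g) ×-dec (eval d′ t ≟ g′))
      ≡⟨ pair-fibre d≢d′ g g′ ⟩
    q ∎
    where open ≡-Reasoning

  H-balanced-pairwise-independent : IsBalancedPairwiseIndependent F H
  H-balanced-pairwise-independent = balanced , pairwise
    where
    balanced : ∀ i g → q * length (filter (λ v → Vec.lookup v i ≟ g) H) ≡ length H
    balanced i g with index-surjective i
    ... | d , refl = trans (cong (q *_) (H-fibre d g)) (sym length-H)
    pairwise : ∀ i j → i ≢ j → ∀ g g′ →
      q * q * length (filter (λ v → (Vec.lookup v i ≟ g) ×-dec (Vec.lookup v j ≟ g′)) H) ≡ length H
    pairwise i j i≢j g g′ with index-surjective i | index-surjective j
    ... | d , refl | d′ , refl = begin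
      q * q * length (filter (λ v → (Vec.lookup v (index d) ≟ g) ×-dec (Vec.lookup v (index d′) ≟ g′)) H)
        ≡⟨ cong (q * q *_) (H-pair-fibre {d} {d′} (i≢j ∘ cong index) g g′) ⟩
      q * q * q    ≡⟨ ℕₚ.*-assoc q q q ⟩
      q * (q * q)  ≡⟨ length-H ⟨
      length H     ∎
      where open ≡-Reasoning

  #roots : Carrier → Carrier → ℕ
  #roots a b = ∑[ x ∈ elements ] 𝟙 (a *ᶠ x +ᶠ b ≟ 0#)

  #roots-constant : ∀ b → #roots 0# b ≡ q * 𝟙 (b ≟ 0#)
  #roots-constant b = ∑-elements-const λ x →
    cong (λ y → 𝟙 (y ≟ 0#)) (trans (cong (_+ᶠ b) (zeroˡ x)) (+-identityˡ b))

  #roots-nonconstant : ∀ {a} → a ≢ 0# → ∀ b → #roots a b ≡ 1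
  #roots-nonconstant {a} a≢0 b =
    trans (∑-elements-𝟙 (λ x → a *ᶠ x +ᶠ b ≟ 0#) root-unique) (𝟙-yes (_ ≟ 0#) root-solves)
    where
    root : Carrier
    root = (-ᶠ b) /⟨ a≢0 ⟩
    root-unique : ∀ x → a *ᶠ x +ᶠ b ≡ 0# → x ≡ root
    root-unique x e = /-unique a≢0 (trans (*-comm x a) (+-inverseˡ-unique _ _ e))
    root-solves : a *ᶠ root +ᶠ b ≡ 0#
    root-solves = trans (cong (_+ᶠ b) (trans (*-comm a root) (/-solves a≢0 (-ᶠ b)))) (-‿inverseˡ b)

  zeros-line : ∀ a b → zeros F (line a b) ≡ #roots a b
  zeros-line a b = count-tabulate (_≟ 0#) (λ x → a *ᶠ x +ᶠ b) to

  zeros-φ : ∀ a b c → zeros F (φ (a , b , c)) ≡ #roots a b + (#roots a c + 0)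
  zeros-φ a b c = begin
    zeros F (line a b Vec.++ (line a c Vec.++ Vec.[]))
      ≡⟨ count-++ (_≟ 0#) (line a b) _ ⟩
    zeros F (line a b) + zeros F (line a c Vec.++ Vec.[])
      ≡⟨ cong (zeros F (line a b) +_) (count-++ (_≟ 0#) (line a c) Vec.[]) ⟩
    zeros F (line a b) + (zeros F (line a c) + 0)
      ≡⟨ cong₂ (λ m n → m + (n + 0)) (zeros-line a b) (zeros-line a c) ⟩
    #roots a b + (#roots a c + 0) ∎
    where open ≡-Reasoning

  H-zeros-even : 2 ∣ q → ∀ {v} → v ∈ H → 2 ∣ zeros F v
  H-zeros-even 2∣q v∈H with ∈-map⁻ φ v∈H
  ... | (a , b , c) , _ , refl rewrite zeros-φ a b c with a ≟ 0#
  ...   | yes refl rewrite #roots-constant b | #roots-constant c =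
    ∣m∣n⇒∣m+n (∣m⇒∣m*n _ 2∣q) (∣m∣n⇒∣m+n (∣m⇒∣m*n _ 2∣q) (2 ∣0))
  ...   | no a≢0 rewrite #roots-nonconstant a≢0 b | #roots-nonconstant a≢0 c = ∣-refl

no-field-of-size-1 : ¬ FiniteField 1
no-field-of-size-1 F = 0≢1 (from-injective (Fin1-irrelevant (from 0#) (from 1#)))
  where
  open FiniteField F
  open Enumeration enum using (from-injective)
  open Inverse enum using (from)
  Fin1-irrelevant : (i j : Fin 1) → i ≡ j
  Fin1-irrelevant Fin.zero Fin.zero = refl

2∣size : ∀ m → FiniteField (2 ^ m) → 2 ∣ 2 ^ m
2∣size zero    F = ⊥-elim (no-field-of-size-1 F)
2∣size (suc m) F = m∣m*n (2 ^ m)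

lemma8 : (m : ℕ) (F : FiniteField (2 ^ m)) →
    Σ (List (Vec (FiniteField.Carrier F) (2 * 2 ^ m))) λ H →
    Unique H × IsSubgroup F H × IsBalancedPairwiseIndependent F H
    × (∀ {x} → x ∈ H → 2 ∣ zeros F x)
lemma8 m F =
  H , H-unique , H-subgroup , H-balanced-pairwise-independent , H-zeros-even (2∣size m F)
  where open Construction F
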